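{- Let $n\ge1$, let $f:\mathfrak S_n(132)\to\mathcal D_n$ be the standard bijection, and let $\pi\in\mathfrak S_n(132)$ and $P\in\mathcal D_n$. Then $f(\pi)=P$ if and only if for all $i,a\in\{1,\dots,n\}$: $$(i,n+1-a)\in\mathrm{LMIN}(\pi)\iff(a,i)\in\mathrm{PEAK}(P).$$
   Context: Permutations are words $a_1\dots a_n$ with $a_i=\pi(i)$; $\mathfrak S_n(132)$ is the set of permutations of length $n$ with no $i<j<k$ such that $a_i<a_k<a_j$. $a_i$ is a left-to-right minimum if $a_i<a_j$ for all $j<i$, and $\mathrm{LMIN}(\pi)=\{(i,a_i): a_i\text{ a left-to-right minimum}\}$. $\mathcal D_n$ is the set of Dyck paths of semilength $n$, written as words in $u$ (up-step) and $d$ (down-step). The standard bijection $f$ is defined recursively on $132$-avoiding words of distinct positive integers (depending only on relative order): $f(\epsilon)=\epsilon$, and if $\pi=\pi_L\,m\,\pi_R$ where $m$ is the largest letter, then $f(\pi)=u\,f(\pi_L)\,d\,f(\pi_R)$. For a Dyck path $P$, index its up-steps $u_1,\dots,u_n$ from left to right and its down-steps $d_1,\dots,d_n$ from left to right; $\mathrm{PEAK}(P)=\{(i,j): u_i \text{ is immediately followed by } d_j \text{ in } P\}$. -}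

module Defs where

open import Data.Nat using (ℕ; zero; suc; _+_; _<_; _≟_)
open import Data.Nat.Properties using (_≤?_)
open import Data.List using (List; []; _∷_; _++_; length; map; upTo)
open import Data.List.Relation.Unary.All using (All)
open import Data.List.Relation.Binary.Permutation.Propositional using (_↭_)
open import Data.Product using (Σ; _×_; _,_; ∃-syntax)
open import Data.Empty using (⊥)
open import Relation.Nullary using (¬_; yes; no)
open import Relation.Binary.PropositionalEquality using (_≡_)

IsPerm : ℕ → List ℕ → Set
IsPerm n π = π ↭ map suc (upTo n)

Avoids132 : List ℕ → Set
Avoids132 π = ∀ (A B C D : List ℕ) (x y z : ℕ) →
  π ≡ A ++ x ∷ B ++ y ∷ C ++ z ∷ D → ¬ (x < z × z < y)

LMIN : List ℕ → ℕ → ℕ → Set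
LMIN π i a = ∃[ A ] ∃[ B ] (π ≡ A ++ a ∷ B × suc (length A) ≡ i × All (a <_) A)

data Step : Set where
  u d : Step

countU : List Step → ℕ
countU []      = 0
countU (u ∷ P) = suc (countU P)
countU (d ∷ P) = countU P

countD : List Step → ℕ
countD []      = 0
countD (u ∷ P) = countD P
countD (d ∷ P) = suc (countD P)

DyckFrom : ℕ → List Step → Set
DyckFrom h       []      = h ≡ 0
DyckFrom h       (u ∷ P) = DyckFrom (suc h) P
DyckFrom zero    (d ∷ P) = ⊥
DyckFrom (suc h) (d ∷ P) = DyckFrom h P

IsDyck : ℕ → List Step → Set
IsDyck n P = countU P ≡ n × DyckFrom 0 P

PEAK : List Step → ℕ → ℕ → Set
PEAK P i j = ∃[ A ] ∃[ B ]
  (P ≡ A ++ u ∷ d ∷ B × suc (countU A) ≡ i × suc (countD A) ≡ j)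

maxL : List ℕ → ℕ
maxL []      = 0
maxL (x ∷ w) with maxL w
... | m with x ≤? m
...   | yes _ = m
...   | no  _ = x

splitAt≡ : ℕ → List ℕ → List ℕ × List ℕ
splitAt≡ m []      = [] , []
splitAt≡ m (x ∷ w) with x ≟ m
... | yes _ = [] , w
... | no  _ with splitAt≡ m w
...   | L , R = x ∷ L , R

-- fuel-driven recursion; fuel ≥ length w suffices (pieces are shorter)
fAux : ℕ → List ℕ → List Step
fAux zero    w       = []
fAux (suc k) []      = []
fAux (suc k) (x ∷ w) with splitAt≡ (maxL (x ∷ w)) (x ∷ w)
... | L , R = u ∷ fAux k L ++ d ∷ fAux k R

-- f(ε) = ε,  f(π_L m π_R) = u f(π_L) d f(π_R)
f : List ℕ → List Step
f w = fAux (length w) w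

-- Both sides follow the recursion of f. Write π = π_L m π_R with m maximal. The peaks of
-- u f(π_L) d f(π_R) are those of f(π_L) moved one up-step to the right, those of f(π_R) moved
-- past u f(π_L) d, and the peak u d itself when π_L is empty. Avoiding 132 forces every letter of
-- π_R below every letter of π_L, so the left-to-right minima of π, each labelled by its rank (the
-- number of letters at least as large), split in exactly the same way. For a permutation of
-- {1,…,n} the rank of v is n+1-v, which gives "⇒"; "⇐" holds because a Dyck path is determined
-- by its length and its set of peaks.
module Submission where

open import Defs
open import Data.Bool using (Bool; true; false)
open import Data.Empty using (⊥; ⊥-elim)
open import Data.List using (List; []; _∷_; _++_; [_]; length; filter; map; upTo)
open import Data.List.Properties
  using (++-assoc; length-++; length-map; length-upTo; map-++; upTo-∷ʳ;
         filter-++; filter-accept; filter-all; filter-none)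
open import Data.List.Membership.Propositional using (_∈_)
open import Data.List.Membership.Propositional.Properties
  using (∈-∃++; ∈-++⁺ˡ; ∈-++⁺ʳ; ∈-map⁻; ∈-upTo⁻)
open import Data.List.Relation.Unary.All as All using (All; []; _∷_)
open import Data.List.Relation.Unary.All.Properties using (++⁻ˡ; ++⁻ʳ)
open import Data.List.Relation.Unary.AllPairs as AllPairs using ([]; _∷_)
open import Data.List.Relation.Unary.Any using (here; there)
open import Data.List.Relation.Unary.Unique.Propositional using (Unique)
open import Data.List.Relation.Unary.Unique.Propositional.Properties using (map⁺; upTo⁺)
open import Data.List.Relation.Binary.Permutation.Propositional using (_↭_; ↭-sym; ↭⇒↭ₛ)
open import Data.List.Relation.Binary.Permutation.Propositional.Properties
  using (↭-length; filter-↭; ∈-resp-↭)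
open import Data.Nat using (ℕ; zero; suc; _+_; _∸_; _≤_; _<_; z≤n; s≤s; _≟_)
open import Data.Nat.Properties
open import Data.Product using (_×_; _,_; ∃-syntax; proj₁; proj₂)
open import Data.Product.Function.NonDependent.Propositional using (_×-⇔_)
open import Data.Sum using (_⊎_; inj₁; inj₂)
open import Data.Sum.Function.Propositional using (_⊎-⇔_)
open import Function.Bundles using (_⇔_; mk⇔; Equivalence)
open import Function.Construct.Composition using (_⇔-∘_)
open import Function.Construct.Identity using (⇔-id)
open import Function.Construct.Symmetry using (⇔-sym)
open import Relation.Nullary using (¬_; yes; no)
open import Relation.Binary.PropositionalEquality
  using (_≡_; _≢_; refl; sym; trans; cong; cong₂; subst; subst₂; ≢-sym; setoid; module ≡-Reasoning)
open import Data.List.Relation.Binary.Permutation.Setoid.Properties (setoid ℕ) using (Unique-resp-↭)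

-- Dyck paths and their peaks

countU-++ : ∀ A B → countU (A ++ B) ≡ countU A + countU B
countU-++ []      B = refl
countU-++ (u ∷ A) B = cong suc (countU-++ A B)
countU-++ (d ∷ A) B = countU-++ A B

countD-++ : ∀ A B → countD (A ++ B) ≡ countD A + countD B
countD-++ []      B = refl
countD-++ (u ∷ A) B = countD-++ A B
countD-++ (d ∷ A) B = cong suc (countD-++ A B)

DyckFrom-counts : ∀ h P → DyckFrom h P → h + countU P ≡ countD P
DyckFrom-counts h       []      refl = refl
DyckFrom-counts h       (u ∷ P) D    = trans (+-suc h (countU P)) (DyckFrom-counts (suc h) P D)
DyckFrom-counts (suc h) (d ∷ P) D    = cong suc (DyckFrom-counts h P D)

DyckFrom-lift : ∀ h X Y → DyckFrom h X → DyckFrom 0 Y → DyckFrom (suc h) (X ++ d ∷ Y)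
DyckFrom-lift zero    []      Y refl DY = DY
DyckFrom-lift h       (u ∷ X) Y DX   DY = DyckFrom-lift (suc h) X Y DX DY
DyckFrom-lift (suc h) (d ∷ X) Y DX   DY = DyckFrom-lift h X Y DX DY

endsUp : Bool → List Step → Bool
endsUp b []      = b
endsUp b (u ∷ P) = endsUp true P
endsUp b (d ∷ P) = endsUp false P

DyckFrom-endsUp : ∀ h b X → DyckFrom h X → endsUp b X ≡ true → X ≡ []
DyckFrom-endsUp h       b []      _  _ = refl
DyckFrom-endsUp h       b (u ∷ X) DX e with DyckFrom-endsUp (suc h) true X DX e
... | refl with () ← DX
DyckFrom-endsUp (suc h) b (d ∷ X) DX e with DyckFrom-endsUp h false X DX e
... | refl with () ← e

-- PeakAfter b uc dc P a i: P, read after a prefix with uc up-steps and dc down-steps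
-- that ends in an up-step iff b, has its a-th up-step followed by its i-th down-step
-- (indices counted in the whole path, so a peak may straddle the prefix boundary).
PeakAfter : Bool → ℕ → ℕ → List Step → ℕ → ℕ → Set
PeakAfter b     uc dc []      a i = ⊥
PeakAfter b     uc dc (u ∷ P) a i = PeakAfter true (suc uc) dc P a i
PeakAfter false uc dc (d ∷ P) a i = PeakAfter false uc (suc dc) P a i
PeakAfter true  uc dc (d ∷ P) a i = (a ≡ uc × i ≡ suc dc) ⊎ PeakAfter false uc (suc dc) P a i

Peak : List Step → ℕ → ℕ → Set
Peak = PeakAfter false 0 0

-- Accumulating variants of countU and countD; with them the lemmas about PeakAfter on an
-- append need no arithmetic.
countUFrom : ℕ → List Step → ℕ
countUFrom c []      = c
countUFrom c (u ∷ A) = countUFrom (suc c) A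
countUFrom c (d ∷ A) = countUFrom c A

countDFrom : ℕ → List Step → ℕ
countDFrom c []      = c
countDFrom c (u ∷ A) = countDFrom c A
countDFrom c (d ∷ A) = countDFrom (suc c) A

countUFrom≡+ : ∀ c A → countUFrom c A ≡ c + countU A
countUFrom≡+ c []      = sym (+-identityʳ c)
countUFrom≡+ c (u ∷ A) = trans (countUFrom≡+ (suc c) A) (sym (+-suc c (countU A)))
countUFrom≡+ c (d ∷ A) = countUFrom≡+ c A

countDFrom≡+ : ∀ c A → countDFrom c A ≡ c + countD A
countDFrom≡+ c []      = sym (+-identityʳ c)
countDFrom≡+ c (u ∷ A) = countDFrom≡+ c A
countDFrom≡+ c (d ∷ A) = trans (countDFrom≡+ (suc c) A) (sym (+-suc c (countD A)))

PeakAfter-++⁺ˡ : ∀ b uc dc A B {a i} → PeakAfter b uc dc A a i → PeakAfter b uc dc (A ++ B) a i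
PeakAfter-++⁺ˡ b     uc dc (u ∷ A) B p        = PeakAfter-++⁺ˡ true (suc uc) dc A B p
PeakAfter-++⁺ˡ false uc dc (d ∷ A) B p        = PeakAfter-++⁺ˡ false uc (suc dc) A B p
PeakAfter-++⁺ˡ true  uc dc (d ∷ A) B (inj₁ p) = inj₁ p
PeakAfter-++⁺ˡ true  uc dc (d ∷ A) B (inj₂ p) = inj₂ (PeakAfter-++⁺ˡ false uc (suc dc) A B p)

PeakAfter-++⁺ʳ : ∀ b uc dc A B {a i} →
                 PeakAfter (endsUp b A) (countUFrom uc A) (countDFrom dc A) B a i →
                 PeakAfter b uc dc (A ++ B) a i
PeakAfter-++⁺ʳ b     uc dc []      B p = p
PeakAfter-++⁺ʳ b     uc dc (u ∷ A) B p = PeakAfter-++⁺ʳ true (suc uc) dc A B p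
PeakAfter-++⁺ʳ false uc dc (d ∷ A) B p = PeakAfter-++⁺ʳ false uc (suc dc) A B p
PeakAfter-++⁺ʳ true  uc dc (d ∷ A) B p = inj₂ (PeakAfter-++⁺ʳ false uc (suc dc) A B p)

PeakAfter-++⁻ : ∀ b uc dc A B {a i} → PeakAfter b uc dc (A ++ B) a i →
                PeakAfter b uc dc A a i ⊎
                PeakAfter (endsUp b A) (countUFrom uc A) (countDFrom dc A) B a i
PeakAfter-++⁻ b     uc dc []      B p        = inj₂ p
PeakAfter-++⁻ b     uc dc (u ∷ A) B p        = PeakAfter-++⁻ true (suc uc) dc A B p
PeakAfter-++⁻ false uc dc (d ∷ A) B p        = PeakAfter-++⁻ false uc (suc dc) A B p
PeakAfter-++⁻ true  uc dc (d ∷ A) B (inj₁ p) = inj₁ (inj₁ p)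
PeakAfter-++⁻ true  uc dc (d ∷ A) B (inj₂ p) with PeakAfter-++⁻ false uc (suc dc) A B p
... | inj₁ q = inj₁ (inj₂ q)
... | inj₂ q = inj₂ q

Shifted : (ℕ → ℕ → Set) → ℕ → ℕ → ℕ → ℕ → Set
Shifted R x y a i = ∃[ a′ ] ∃[ i′ ] (a ≡ a′ + x × i ≡ i′ + y × R a′ i′)

Shifted-⇔ : ∀ {R R′ : ℕ → ℕ → Set} {x y a i} → (∀ {a i} → R a i ⇔ R′ a i) →
            Shifted R x y a i ⇔ Shifted R′ x y a i
Shifted-⇔ R⇔R′ = mk⇔ (λ (a′ , i′ , p , q , r) → a′ , i′ , p , q , Equivalence.to R⇔R′ r)
                     (λ (a′ , i′ , p , q , r) → a′ , i′ , p , q , Equivalence.from R⇔R′ r)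

PeakAfter-shift⁺ : ∀ b uc dc P x y {a i} → PeakAfter b uc dc P a i →
                   PeakAfter b (uc + x) (dc + y) P (a + x) (i + y)
PeakAfter-shift⁺ b     uc dc (u ∷ P) x y p = PeakAfter-shift⁺ true (suc uc) dc P x y p
PeakAfter-shift⁺ false uc dc (d ∷ P) x y p = PeakAfter-shift⁺ false uc (suc dc) P x y p
PeakAfter-shift⁺ true  uc dc (d ∷ P) x y (inj₁ (refl , refl)) = inj₁ (refl , refl)
PeakAfter-shift⁺ true  uc dc (d ∷ P) x y (inj₂ p) = inj₂ (PeakAfter-shift⁺ false uc (suc dc) P x y p)

PeakAfter-shift⁻ : ∀ b uc dc P x y {a i} → PeakAfter b (uc + x) (dc + y) P a i →
                   Shifted (PeakAfter b uc dc P) x y a i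
PeakAfter-shift⁻ b     uc dc (u ∷ P) x y p = PeakAfter-shift⁻ true (suc uc) dc P x y p
PeakAfter-shift⁻ false uc dc (d ∷ P) x y p = PeakAfter-shift⁻ false uc (suc dc) P x y p
PeakAfter-shift⁻ true  uc dc (d ∷ P) x y (inj₁ (refl , refl)) = uc , suc dc , refl , refl , inj₁ (refl , refl)
PeakAfter-shift⁻ true  uc dc (d ∷ P) x y (inj₂ p) with PeakAfter-shift⁻ false uc (suc dc) P x y p
... | a′ , i′ , refl , refl , q = a′ , i′ , refl , refl , inj₂ q

PeakAfter⇔Shifted : ∀ b x y P {a i} → PeakAfter b x y P a i ⇔ Shifted (PeakAfter b 0 0 P) x y a i
PeakAfter⇔Shifted b x y P = mk⇔ (PeakAfter-shift⁻ b 0 0 P x y)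
                                (λ { (a′ , i′ , refl , refl , p) → PeakAfter-shift⁺ b 0 0 P x y p })

PeakAfter-decompose : ∀ b uc dc P {a i} → PeakAfter b uc dc P a i →
  (b ≡ true × (∃[ B ] P ≡ d ∷ B) × a ≡ uc × i ≡ suc dc) ⊎
  (∃[ A ] ∃[ B ] (P ≡ A ++ u ∷ d ∷ B × a ≡ suc (countUFrom uc A) × i ≡ suc (countDFrom dc A)))
PeakAfter-decompose b uc dc (u ∷ P) p with PeakAfter-decompose true (suc uc) dc P p
... | inj₁ (_ , (B , refl) , refl , refl)          = inj₂ ([] , B , refl , refl , refl)
... | inj₂ (A , B , refl , refl , refl)             = inj₂ (u ∷ A , B , refl , refl , refl)
PeakAfter-decompose false uc dc (d ∷ P) p with PeakAfter-decompose false uc (suc dc) P p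
... | inj₂ (A , B , refl , refl , refl)             = inj₂ (d ∷ A , B , refl , refl , refl)
PeakAfter-decompose true uc dc (d ∷ P) (inj₁ (refl , refl)) = inj₁ (refl , (P , refl) , refl , refl)
PeakAfter-decompose true uc dc (d ∷ P) (inj₂ p) with PeakAfter-decompose false uc (suc dc) P p
... | inj₂ (A , B , refl , refl , refl)             = inj₂ (d ∷ A , B , refl , refl , refl)

PEAK⇔Peak : ∀ P {a i} → PEAK P a i ⇔ Peak P a i
PEAK⇔Peak P = mk⇔ to from
  where
  to : ∀ {a i} → PEAK P a i → Peak P a i
  to (A , B , refl , refl , refl) =
    PeakAfter-++⁺ʳ false 0 0 A (u ∷ d ∷ B)
      (inj₁ (cong suc (sym (countUFrom≡+ 0 A)) , cong suc (sym (countDFrom≡+ 0 A))))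
  from : ∀ {a i} → Peak P a i → PEAK P a i
  from p with PeakAfter-decompose false 0 0 P p
  ... | inj₂ (A , B , eq , refl , refl) =
    A , B , eq , cong suc (sym (countUFrom≡+ 0 A)) , cong suc (sym (countDFrom≡+ 0 A))

PeakAfter-up≥ : ∀ b uc dc P {a i} → PeakAfter b uc dc P a i → uc ≤ a
PeakAfter-up≥ b     uc dc (u ∷ P) p = ≤-trans (n≤1+n uc) (PeakAfter-up≥ true (suc uc) dc P p)
PeakAfter-up≥ false uc dc (d ∷ P) p = PeakAfter-up≥ false uc (suc dc) P p
PeakAfter-up≥ true  uc dc (d ∷ P) (inj₁ (refl , _)) = ≤-refl
PeakAfter-up≥ true  uc dc (d ∷ P) (inj₂ p) = PeakAfter-up≥ false uc (suc dc) P p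

PeakAfter-down> : ∀ b uc dc P {a i} → PeakAfter b uc dc P a i → dc < i
PeakAfter-down> b     uc dc (u ∷ P) p = PeakAfter-down> true (suc uc) dc P p
PeakAfter-down> false uc dc (d ∷ P) p = <-trans (n<1+n dc) (PeakAfter-down> false uc (suc dc) P p)
PeakAfter-down> true  uc dc (d ∷ P) (inj₁ (_ , refl)) = n<1+n dc
PeakAfter-down> true  uc dc (d ∷ P) (inj₂ p) = <-trans (n<1+n dc) (PeakAfter-down> false uc (suc dc) P p)

PeakAfter-d∷⁺ : ∀ b uc dc P {a i} → PeakAfter false uc (suc dc) P a i → PeakAfter b uc dc (d ∷ P) a i
PeakAfter-d∷⁺ false uc dc P p = p
PeakAfter-d∷⁺ true  uc dc P p = inj₂ p

PeakAfter-d∷⁻ : ∀ b uc dc P {a i} → PeakAfter b uc dc (d ∷ P) a i → suc dc < i →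
                PeakAfter false uc (suc dc) P a i
PeakAfter-d∷⁻ false uc dc P p        _ = p
PeakAfter-d∷⁻ true  uc dc P (inj₁ (_ , refl)) dc<i = ⊥-elim (<-irrefl refl dc<i)
PeakAfter-d∷⁻ true  uc dc P (inj₂ p) _ = p

PeakAfter-d∷-split : ∀ b uc dc P {a i} → PeakAfter b uc dc (d ∷ P) a i →
                     (b ≡ true × a ≡ uc × i ≡ suc dc) ⊎ PeakAfter false uc (suc dc) P a i
PeakAfter-d∷-split false uc dc P p        = inj₂ p
PeakAfter-d∷-split true  uc dc P (inj₁ (refl , refl)) = inj₁ (refl , refl , refl)
PeakAfter-d∷-split true  uc dc P (inj₂ p) = inj₂ p

PeakAfter-firstDown : ∀ uc dc P k → countD P ≡ suc k → ∃[ a ] PeakAfter true uc dc P a (suc dc)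
PeakAfter-firstDown uc dc (u ∷ P) k e = PeakAfter-firstDown (suc uc) dc P k e
PeakAfter-firstDown uc dc (d ∷ P) k e = uc , inj₁ (refl , refl)

-- The first down-step of u ∷ P closes a peak with down-index suc dc and up-index > uc;
-- d ∷ Q can only have such a peak at up-index uc.
PeakAfter-u∷⊈d∷ : ∀ b uc dc P Q → countD P ≡ suc (countD Q) →
                  ¬ (∀ {a i} → PeakAfter b uc dc (u ∷ P) a i → PeakAfter b uc dc (d ∷ Q) a i)
PeakAfter-u∷⊈d∷ b uc dc P Q e incl with PeakAfter-firstDown (suc uc) dc P (countD Q) e
... | a , p with PeakAfter-up≥ true (suc uc) dc P p | incl p
PeakAfter-u∷⊈d∷ false uc dc P Q e incl | a , p | _ | q =
  <-irrefl refl (PeakAfter-down> false uc (suc dc) Q q)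
PeakAfter-u∷⊈d∷ true uc dc P Q e incl | a , p | uc<a | inj₁ (refl , _) = <-irrefl refl uc<a
PeakAfter-u∷⊈d∷ true uc dc P Q e incl | a , p | _ | inj₂ q =
  <-irrefl refl (PeakAfter-down> false uc (suc dc) Q q)

PeakAfter-injective : ∀ b uc dc P Q → countU P ≡ countU Q → countD P ≡ countD Q →
                      (∀ {a i} → PeakAfter b uc dc P a i ⇔ PeakAfter b uc dc Q a i) → P ≡ Q
PeakAfter-injective b uc dc []      []      _  _  _ = refl
PeakAfter-injective b uc dc []      (u ∷ Q) () _  _
PeakAfter-injective b uc dc []      (d ∷ Q) _  () _
PeakAfter-injective b uc dc (u ∷ P) []      () _  _
PeakAfter-injective b uc dc (d ∷ P) []      _  () _
PeakAfter-injective b uc dc (u ∷ P) (u ∷ Q) eU eD P⇔Q =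
  cong (u ∷_) (PeakAfter-injective true (suc uc) dc P Q (suc-injective eU) eD P⇔Q)
PeakAfter-injective b uc dc (u ∷ P) (d ∷ Q) eU eD P⇔Q =
  ⊥-elim (PeakAfter-u∷⊈d∷ b uc dc P Q eD (Equivalence.to P⇔Q))
PeakAfter-injective b uc dc (d ∷ P) (u ∷ Q) eU eD P⇔Q =
  ⊥-elim (PeakAfter-u∷⊈d∷ b uc dc Q P (sym eD) (Equivalence.from P⇔Q))
PeakAfter-injective b uc dc (d ∷ P) (d ∷ Q) eU eD P⇔Q =
  cong (d ∷_) (PeakAfter-injective false uc (suc dc) P Q eU (suc-injective eD) (mk⇔ to from))
  where
  to : ∀ {a i} → PeakAfter false uc (suc dc) P a i → PeakAfter false uc (suc dc) Q a i
  to p = PeakAfter-d∷⁻ b uc dc Q (Equivalence.to P⇔Q (PeakAfter-d∷⁺ b uc dc P p))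
                       (PeakAfter-down> false uc (suc dc) P p)
  from : ∀ {a i} → PeakAfter false uc (suc dc) Q a i → PeakAfter false uc (suc dc) P a i
  from q = PeakAfter-d∷⁻ b uc dc P (Equivalence.from P⇔Q (PeakAfter-d∷⁺ b uc dc Q q))
                         (PeakAfter-down> false uc (suc dc) Q q)

PEAK-bounds : ∀ {n} P {a i} → countU P ≡ n → countD P ≡ n → PEAK P a i →
              1 ≤ i × i ≤ n × 1 ≤ a × a ≤ n
PEAK-bounds P refl dP (A , B , refl , refl , refl) =
  s≤s z≤n , ≤-trans (m<m+n (countD A) (s≤s z≤n)) (≤-reflexive (trans (sym (countD-++ A (u ∷ d ∷ B))) dP)) ,
  s≤s z≤n , ≤-trans (m<m+n (countU A) (s≤s z≤n)) (≤-reflexive (sym (countU-++ A (u ∷ d ∷ B))))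

PEAK-injective : ∀ {n} P Q → countU P ≡ n → countD P ≡ n → countU Q ≡ n → countD Q ≡ n →
                 (∀ i a → 1 ≤ i → i ≤ n → 1 ≤ a → a ≤ n → PEAK P a i ⇔ PEAK Q a i) → P ≡ Q
PEAK-injective P Q uP dP uQ dQ agree =
  PeakAfter-injective false 0 0 P Q (trans uP (sym uQ)) (trans dP (sym dQ)) (mk⇔ to from)
  where
  to : ∀ {a i} → Peak P a i → Peak Q a i
  to {a} {i} p with pk ← Equivalence.from (PEAK⇔Peak P) p
               with 1≤i , i≤n , 1≤a , a≤n ← PEAK-bounds P uP dP pk =
    Equivalence.to (PEAK⇔Peak Q) (Equivalence.to (agree i a 1≤i i≤n 1≤a a≤n) pk)
  from : ∀ {a i} → Peak Q a i → Peak P a i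
  from {a} {i} q with pk ← Equivalence.from (PEAK⇔Peak Q) q
                 with 1≤i , i≤n , 1≤a , a≤n ← PEAK-bounds Q uQ dQ pk =
    Equivalence.to (PEAK⇔Peak P) (Equivalence.from (agree i a 1≤i i≤n 1≤a a≤n) pk)

-- A Dyck path does not start with a down-step, so no peak straddles its left end.
DyckFrom-PeakAfter-flag : ∀ uc dc X {a i} → DyckFrom 0 X →
                          PeakAfter true uc dc X a i ⇔ PeakAfter false uc dc X a i
DyckFrom-PeakAfter-flag uc dc []      _ = ⇔-id _
DyckFrom-PeakAfter-flag uc dc (u ∷ X) _ = ⇔-id _

-- The pairs of u X d Y (or of L m R) in terms of those of X and Y (of L and R): the left
-- part shifted by (1,0), the pair (1,1) when the left part is empty, and the right part
-- shifted past the left part and the middle step(s).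
Glued : (ℕ → ℕ → Set) → Set → (ℕ → ℕ → Set) → ℕ → ℕ → ℕ → ℕ → Set
Glued RL empty RR x y a i =
  Shifted RL 1 0 a i ⊎ ((empty × a ≡ 1 × i ≡ 1) ⊎ Shifted RR (suc x) (suc y) a i)

Glued-⇔ : ∀ {RL RL′ RR RR′ : ℕ → ℕ → Set} {E E′ : Set} {x y a i} →
          (∀ {a i} → RL a i ⇔ RL′ a i) → E ⇔ E′ → (∀ {a i} → RR a i ⇔ RR′ a i) →
          Glued RL E RR x y a i ⇔ Glued RL′ E′ RR′ x y a i
Glued-⇔ L⇔ E⇔ R⇔ = Shifted-⇔ L⇔ ⊎-⇔ ((E⇔ ×-⇔ ⇔-id _) ⊎-⇔ Shifted-⇔ R⇔)

Peak-lift : ∀ X Y {a i} → DyckFrom 0 X →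
            Peak (u ∷ X ++ d ∷ Y) a i ⇔ Glued (Peak X) (X ≡ []) (Peak Y) (countU X) (countD X) a i
Peak-lift X Y {a} {i} DX = mk⇔ to from
  where
  left : PeakAfter true 1 0 X a i ⇔ Shifted (Peak X) 1 0 a i
  left = PeakAfter⇔Shifted false 1 0 X ⇔-∘ DyckFrom-PeakAfter-flag 1 0 X DX
  right : PeakAfter false (countUFrom 1 X) (suc (countDFrom 0 X)) Y a i ⇔
          Shifted (Peak Y) (suc (countU X)) (suc (countD X)) a i
  right rewrite countUFrom≡+ 1 X | countDFrom≡+ 0 X = PeakAfter⇔Shifted false _ _ Y
  to : Peak (u ∷ X ++ d ∷ Y) a i → Glued (Peak X) (X ≡ []) (Peak Y) (countU X) (countD X) a i
  to p with PeakAfter-++⁻ true 1 0 X (d ∷ Y) p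
  ... | inj₁ q = inj₁ (Equivalence.to left q)
  ... | inj₂ q with PeakAfter-d∷-split (endsUp true X) _ _ Y q
  ...   | inj₂ r = inj₂ (inj₂ (Equivalence.to right r))
  ...   | inj₁ (endsInUp , refl , refl) with refl ← DyckFrom-endsUp 0 true X DX endsInUp =
    inj₂ (inj₁ (refl , refl , refl))
  from : Glued (Peak X) (X ≡ []) (Peak Y) (countU X) (countD X) a i → Peak (u ∷ X ++ d ∷ Y) a i
  from (inj₁ s)                           = PeakAfter-++⁺ˡ true 1 0 X (d ∷ Y) (Equivalence.from left s)
  from (inj₂ (inj₁ (refl , refl , refl))) = inj₁ (refl , refl)
  from (inj₂ (inj₂ s)) =
    PeakAfter-++⁺ʳ true 1 0 X (d ∷ Y) (PeakAfter-d∷⁺ (endsUp true X) _ _ Y (Equivalence.from right s))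

-- Left-to-right minima and ranks

LeftMin : List ℕ → ℕ → ℕ → Set
LeftMin []      i v = ⊥
LeftMin (x ∷ w) i v = (i ≡ 1 × v ≡ x) ⊎ (v < x × ∃[ j ] (i ≡ suc j × LeftMin w j v))

LeftMin-++⁺ʳ : ∀ A B {i v} → All (v <_) A → LeftMin B i v → LeftMin (A ++ B) (length A + i) v
LeftMin-++⁺ʳ []      B v<A         lm = lm
LeftMin-++⁺ʳ (x ∷ A) B (v<x ∷ v<A) lm = inj₂ (v<x , _ , refl , LeftMin-++⁺ʳ A B v<A lm)

LMIN⇔LeftMin : ∀ w {i v} → LMIN w i v ⇔ LeftMin w i v
LMIN⇔LeftMin w = mk⇔ to (from w)
  where
  to : ∀ {w i v} → LMIN w i v → LeftMin w i v
  to {v = v} (A , B , refl , refl , v<A) =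
    subst (λ i → LeftMin (A ++ v ∷ B) i v) (+-comm (length A) 1)
          (LeftMin-++⁺ʳ A (v ∷ B) v<A (inj₁ (refl , refl)))
  from : ∀ w {i v} → LeftMin w i v → LMIN w i v
  from (x ∷ w) (inj₁ (refl , refl)) = [] , w , refl , refl , []
  from (x ∷ w) (inj₂ (v<x , j , refl , lm)) with from w lm
  ... | A , B , refl , refl , v<A = x ∷ A , B , refl , refl , v<x ∷ v<A

LeftMin-∈ : ∀ w {i v} → LeftMin w i v → v ∈ w
LeftMin-∈ (x ∷ w) (inj₁ (_ , refl))      = here refl
LeftMin-∈ (x ∷ w) (inj₂ (_ , _ , _ , lm)) = there (LeftMin-∈ w lm)

LeftMin-++⁺ˡ : ∀ A B {i v} → LeftMin A i v → LeftMin (A ++ B) i v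
LeftMin-++⁺ˡ (x ∷ A) B (inj₁ p)                 = inj₁ p
LeftMin-++⁺ˡ (x ∷ A) B (inj₂ (v<x , j , e , lm)) = inj₂ (v<x , j , e , LeftMin-++⁺ˡ A B lm)

LeftMin-++⁻ : ∀ A B {i v} → LeftMin (A ++ B) i v →
              LeftMin A i v ⊎ (All (v <_) A × ∃[ j ] (i ≡ length A + j × LeftMin B j v))
LeftMin-++⁻ []      B lm                           = inj₂ ([] , _ , refl , lm)
LeftMin-++⁻ (x ∷ A) B (inj₁ p)                     = inj₁ (inj₁ p)
LeftMin-++⁻ (x ∷ A) B (inj₂ (v<x , j , refl , lm)) with LeftMin-++⁻ A B lm
... | inj₁ lmA                     = inj₁ (inj₂ (v<x , j , refl , lmA))
... | inj₂ (v<A , j′ , refl , lmB) = inj₂ (v<x ∷ v<A , j′ , refl , lmB)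

rank : List ℕ → ℕ → ℕ
rank w v = length (filter (v ≤?_) w)

rank-++ : ∀ A B v → rank (A ++ B) v ≡ rank A v + rank B v
rank-++ A B v = trans (cong length (filter-++ (v ≤?_) A B)) (length-++ (filter (v ≤?_) A))

rank-∷-≤ : ∀ {x} w {v} → v ≤ x → rank (x ∷ w) v ≡ suc (rank w v)
rank-∷-≤ w {v} v≤x = cong length (filter-accept (v ≤?_) v≤x)

rank-all> : ∀ A {v} → All (v <_) A → rank A v ≡ length A
rank-all> A {v} v<A = cong length (filter-all (v ≤?_) (All.map <⇒≤ v<A))

rank-all< : ∀ A {v} → All (_< v) A → rank A v ≡ 0
rank-all< A {v} A<v = cong length (filter-none (v ≤?_) (All.map <⇒≱ A<v))

rank-↭ : ∀ {xs ys} v → xs ↭ ys → rank xs v ≡ rank ys v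
rank-↭ v p = ↭-length (filter-↭ (v ≤?_) p)

RankedLMin : List ℕ → ℕ → ℕ → Set
RankedLMin w a i = ∃[ v ] (LeftMin w i v × rank w v ≡ a)

+-suc-comm : ∀ p q → p + suc q ≡ q + suc p
+-suc-comm p q = trans (+-comm p (suc q)) (sym (+-suc q p))

All<∧All>⇒≡[] : ∀ {m} L → All (_< m) L → All (m <_) L → L ≡ []
All<∧All>⇒≡[] []      []        []        = refl
All<∧All>⇒≡[] (y ∷ L) (y<m ∷ _) (m<y ∷ _) = ⊥-elim (<-asym y<m m<y)

RankedLMin-glue : ∀ L m R {a i} → All (_< m) L → All (_< m) R → (∀ {y z} → y ∈ L → z ∈ R → z < y) →
                  RankedLMin (L ++ m ∷ R) a i ⇔
                  Glued (RankedLMin L) (L ≡ []) (RankedLMin R) (length L) (length L) a i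
RankedLMin-glue L m R {a} {i} L<m R<m R<L = mk⇔ to from
  where
  w : List ℕ
  w = L ++ m ∷ R
  rank-left : ∀ {v} → v ∈ L → rank w v ≡ rank L v + 1
  rank-left {v} v∈L = begin
    rank w v                    ≡⟨ rank-++ L (m ∷ R) v ⟩
    rank L v + rank (m ∷ R) v   ≡⟨ cong (rank L v +_) (rank-∷-≤ R (<⇒≤ (All.lookup L<m v∈L))) ⟩
    rank L v + suc (rank R v)   ≡⟨ cong (λ r → rank L v + suc r) (rank-all< R (All.tabulate (R<L v∈L))) ⟩
    rank L v + 1                ∎
    where open ≡-Reasoning
  rank-right : ∀ {v} → v ∈ R → rank w v ≡ rank R v + suc (length L)
  rank-right {v} v∈R = begin
    rank w v                    ≡⟨ rank-++ L (m ∷ R) v ⟩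
    rank L v + rank (m ∷ R) v   ≡⟨ cong₂ _+_ (rank-all> L (All.tabulate (λ y∈L → R<L y∈L v∈R)))
                                             (rank-∷-≤ R (<⇒≤ (All.lookup R<m v∈R))) ⟩
    length L + suc (rank R v)   ≡⟨ +-suc-comm (length L) (rank R v) ⟩
    rank R v + suc (length L)   ∎
    where open ≡-Reasoning
  rank-max : rank w m ≡ 1
  rank-max = begin
    rank w m                  ≡⟨ rank-++ L (m ∷ R) m ⟩
    rank L m + rank (m ∷ R) m ≡⟨ cong₂ _+_ (rank-all< L L<m) (rank-∷-≤ R ≤-refl) ⟩
    suc (rank R m)            ≡⟨ cong suc (rank-all< R R<m) ⟩
    1                         ∎
    where open ≡-Reasoning
  to : RankedLMin w a i → Glued (RankedLMin L) (L ≡ []) (RankedLMin R) (length L) (length L) a i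
  to (v , lm , refl) with LeftMin-++⁻ L (m ∷ R) lm
  ... | inj₁ lmL =
    inj₁ (rank L v , i , rank-left (LeftMin-∈ L lmL) , sym (+-identityʳ i) , v , lmL , refl)
  ... | inj₂ (m<L , _ , refl , inj₁ (refl , refl)) with refl ← All<∧All>⇒≡[] L L<m m<L =
    inj₂ (inj₁ (refl , rank-max , refl))
  ... | inj₂ (_ , _ , refl , inj₂ (v<m , j , refl , lmR)) =
    inj₂ (inj₂ (rank R v , j , rank-right (LeftMin-∈ R lmR) , +-suc-comm (length L) j , v , lmR , refl))
  from : Glued (RankedLMin L) (L ≡ []) (RankedLMin R) (length L) (length L) a i → RankedLMin w a i
  from (inj₁ (_ , i′ , refl , refl , v , lmL , refl)) =
    v , subst (λ j → LeftMin w j v) (sym (+-identityʳ i′)) (LeftMin-++⁺ˡ L (m ∷ R) lmL) ,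
    rank-left (LeftMin-∈ L lmL)
  from (inj₂ (inj₁ (L≡[] , refl , refl))) =
    m , subst (λ A → LeftMin (A ++ m ∷ R) 1 m) (sym L≡[]) (inj₁ (refl , refl)) , rank-max
  from (inj₂ (inj₂ (_ , j , refl , refl , v , lmR , refl))) =
    v , subst (λ k → LeftMin w k v) (+-suc-comm (length L) j)
              (LeftMin-++⁺ʳ L (m ∷ R) (All.tabulate (λ y∈L → R<L y∈L v∈R))
                 (inj₂ (All.lookup R<m v∈R , j , refl , lmR))) ,
    rank-right v∈R
    where
    v∈R : v ∈ R
    v∈R = LeftMin-∈ R lmR

-- The standard bijection

maxL-upper : ∀ w → All (_≤ maxL w) w
maxL-upper []      = []
maxL-upper (x ∷ w) with maxL w | maxL-upper w
... | m | w≤m with x ≤? m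
...   | yes x≤m = x≤m ∷ w≤m
...   | no  x≰m = ≤-refl ∷ All.map (λ y≤m → ≤-trans y≤m (<⇒≤ (≰⇒> x≰m))) w≤m

maxL-∈ : ∀ x w → maxL (x ∷ w) ∈ x ∷ w
maxL-∈ x []      with x ≤? 0
... | yes x≤0 = here (sym (n≤0⇒n≡0 x≤0))
... | no  _   = here refl
maxL-∈ x (y ∷ w) with maxL (y ∷ w) | maxL-∈ y w
... | m | m∈ with x ≤? m
...   | yes _ = there m∈
...   | no  _ = here refl

splitAt≡-++ : ∀ m w → m ∈ w → w ≡ proj₁ (splitAt≡ m w) ++ m ∷ proj₂ (splitAt≡ m w)
splitAt≡-++ m (x ∷ w) m∈ with x ≟ m
... | yes refl = refl
splitAt≡-++ m (x ∷ w) (here refl) | no x≢m = ⊥-elim (x≢m refl)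
splitAt≡-++ m (x ∷ w) (there m∈) | no _ with splitAt≡ m w | splitAt≡-++ m w m∈
... | L , R | eq = cong (x ∷_) eq

module _ (x : ℕ) (w : List ℕ) where

  maxLeft maxRight : List ℕ
  maxLeft  = proj₁ (splitAt≡ (maxL (x ∷ w)) (x ∷ w))
  maxRight = proj₂ (splitAt≡ (maxL (x ∷ w)) (x ∷ w))

  split-at-max : x ∷ w ≡ maxLeft ++ maxL (x ∷ w) ∷ maxRight
  split-at-max = splitAt≡-++ (maxL (x ∷ w)) (x ∷ w) (maxL-∈ x w)

  fAux-suc : ∀ k → fAux (suc k) (x ∷ w) ≡ u ∷ fAux k maxLeft ++ d ∷ fAux k maxRight
  fAux-suc k with splitAt≡ (maxL (x ∷ w)) (x ∷ w)
  ... | L , R = refl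

fAux-Dyck : ∀ k w → DyckFrom 0 (fAux k w)
fAux-Dyck zero    w       = refl
fAux-Dyck (suc k) []      = refl
fAux-Dyck (suc k) (x ∷ w) rewrite fAux-suc x w k =
  DyckFrom-lift 0 (fAux k (maxLeft x w)) (fAux k (maxRight x w))
                (fAux-Dyck k (maxLeft x w)) (fAux-Dyck k (maxRight x w))

length-++-∷≤ : ∀ (L : List ℕ) {m} R {k} → length (L ++ m ∷ R) ≤ suc k → length L ≤ k × length R ≤ k
length-++-∷≤ L R {k} le =
  ≤-pred (≤-trans (m<m+n (length L) (s≤s z≤n)) le′) , ≤-pred (≤-trans (m≤n+m _ (length L)) le′)
  where
  le′ : length L + suc (length R) ≤ suc k
  le′ = ≤-trans (≤-reflexive (sym (length-++ L))) le

fAux-countU : ∀ k w → length w ≤ k → countU (fAux k w) ≡ length w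
fAux-countU zero    []      _  = refl
fAux-countU (suc k) []      _  = refl
fAux-countU (suc k) (x ∷ w) le rewrite fAux-suc x w k = begin
  suc (countU (fAux k L ++ d ∷ fAux k R))     ≡⟨ cong suc (countU-++ (fAux k L) _) ⟩
  suc (countU (fAux k L) + countU (fAux k R)) ≡⟨ cong₂ (λ p q → suc (p + q)) (fAux-countU k L L≤k)
                                                                              (fAux-countU k R R≤k) ⟩
  suc (length L + length R)                   ≡⟨ sym (+-suc (length L) (length R)) ⟩
  length L + suc (length R)                   ≡⟨ sym (length-++ L) ⟩
  length (L ++ maxL (x ∷ w) ∷ R)              ≡⟨ cong length (sym (split-at-max x w)) ⟩
  length (x ∷ w)                              ∎
  where
  open ≡-Reasoning
  L R : List ℕ
  L = maxLeft x w
  R = maxRight x w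
  lengths : length L ≤ k × length R ≤ k
  lengths = length-++-∷≤ L R (subst (λ v → length v ≤ suc k) (split-at-max x w) le)
  L≤k : length L ≤ k
  L≤k = proj₁ lengths
  R≤k : length R ≤ k
  R≤k = proj₂ lengths

fAux-countD : ∀ k w → length w ≤ k → countD (fAux k w) ≡ length w
fAux-countD k w le = trans (sym (DyckFrom-counts 0 (fAux k w) (fAux-Dyck k w))) (fAux-countU k w le)

fAux-≡[]⇔ : ∀ k w → length w ≤ k → fAux k w ≡ [] ⇔ w ≡ []
fAux-≡[]⇔ k []      _ = mk⇔ (λ _ → refl) (λ _ → fAux-[] k)
  where
  fAux-[] : ∀ k → fAux k [] ≡ []
  fAux-[] zero    = refl
  fAux-[] (suc k) = refl
fAux-≡[]⇔ (suc k) (x ∷ w) _ rewrite fAux-suc x w k = mk⇔ (λ ()) (λ ())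

Unique-++⁻ : ∀ (A : List ℕ) {B} → Unique (A ++ B) → Unique A × Unique B × (∀ {x z} → x ∈ A → z ∈ B → x ≢ z)
Unique-++⁻ []      U          = [] , U , λ ()
Unique-++⁻ (a ∷ A) {B} (a∉ ∷ U) with Unique-++⁻ A U
... | UA , UB , A#B = ++⁻ˡ A a∉ ∷ UA , UB , disjoint
  where
  disjoint : ∀ {x z} → x ∈ a ∷ A → z ∈ B → x ≢ z
  disjoint (here refl) z∈B = All.lookup (++⁻ʳ A a∉) z∈B
  disjoint (there x∈A) z∈B = A#B x∈A z∈B

Avoids132-++⁻ˡ : ∀ A B → Avoids132 (A ++ B) → Avoids132 A
Avoids132-++⁻ˡ A B av A′ B′ C D x y z refl = av A′ B′ C (D ++ B) x y z (begin
  (A′ ++ x ∷ B′ ++ y ∷ C ++ z ∷ D) ++ B   ≡⟨ ++-assoc A′ _ B ⟩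
  A′ ++ x ∷ (B′ ++ y ∷ C ++ z ∷ D) ++ B   ≡⟨ cong (λ t → A′ ++ x ∷ t) (++-assoc B′ _ B) ⟩
  A′ ++ x ∷ B′ ++ y ∷ (C ++ z ∷ D) ++ B   ≡⟨ cong (λ t → A′ ++ x ∷ B′ ++ y ∷ t) (++-assoc C _ B) ⟩
  A′ ++ x ∷ B′ ++ y ∷ C ++ z ∷ D ++ B     ∎)
  where open ≡-Reasoning

Avoids132-++⁻ʳ : ∀ A B → Avoids132 (A ++ B) → Avoids132 B
Avoids132-++⁻ʳ A B av A′ B′ C D x y z refl = av (A ++ A′) B′ C D x y z (sym (++-assoc A A′ _))

Avoids132-split : ∀ L m R {y z} → Avoids132 (L ++ m ∷ R) → y ∈ L → z ∈ R → z < m → z ≤ y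
Avoids132-split L m R av y∈L z∈R z<m with ∈-∃++ y∈L | ∈-∃++ z∈R
... | A , B , refl | C , D , refl = ≮⇒≥ λ y<z → av A B C D _ m _ (++-assoc A _ _) (y<z , z<m)

Peak-fAux-glue : ∀ k L m R →
  (∀ w → length w ≤ k → Unique w → Avoids132 w → ∀ {a i} → Peak (fAux k w) a i ⇔ RankedLMin w a i) →
  length (L ++ m ∷ R) ≤ suc k → Unique (L ++ m ∷ R) → Avoids132 (L ++ m ∷ R) → All (_≤ m) (L ++ m ∷ R) →
  ∀ {a i} → Peak (u ∷ fAux k L ++ d ∷ fAux k R) a i ⇔ RankedLMin (L ++ m ∷ R) a i
Peak-fAux-glue k L m R IH le U av ≤m {a} {i} =
  ⇔-sym (RankedLMin-glue L m R L<m R<m R<L)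
    ⇔-∘ (Glued-⇔ (IH L L≤k UL avL) (fAux-≡[]⇔ k L L≤k) (IH R R≤k UR avR)
    ⇔-∘ lift)
  where
  X Y : List Step
  X = fAux k L
  Y = fAux k R
  L≤k : length L ≤ k
  L≤k = proj₁ (length-++-∷≤ L R le)
  R≤k : length R ≤ k
  R≤k = proj₂ (length-++-∷≤ L R le)
  UL : Unique L
  UL = proj₁ (Unique-++⁻ L U)
  UmR : Unique (m ∷ R)
  UmR = proj₁ (proj₂ (Unique-++⁻ L U))
  UR : Unique R
  UR = AllPairs.tail UmR
  L#mR : ∀ {y z} → y ∈ L → z ∈ m ∷ R → y ≢ z
  L#mR = proj₂ (proj₂ (Unique-++⁻ L U))
  avL : Avoids132 L
  avL = Avoids132-++⁻ˡ L (m ∷ R) av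
  avR : Avoids132 R
  avR = Avoids132-++⁻ʳ (m ∷ []) R (Avoids132-++⁻ʳ L (m ∷ R) av)
  lift : Peak (u ∷ X ++ d ∷ Y) a i ⇔ Glued (Peak X) (X ≡ []) (Peak Y) (length L) (length L) a i
  lift = subst₂ (λ p q → Peak (u ∷ X ++ d ∷ Y) a i ⇔ Glued (Peak X) (X ≡ []) (Peak Y) p q a i)
                (fAux-countU k L L≤k) (fAux-countD k L L≤k) (Peak-lift X Y (fAux-Dyck k L))
  L<m : All (_< m) L
  L<m = All.tabulate λ y∈L → ≤∧≢⇒< (All.lookup ≤m (∈-++⁺ˡ y∈L)) (L#mR y∈L (here refl))
  R<m : All (_< m) R
  R<m = All.tabulate λ z∈R →
    ≤∧≢⇒< (All.lookup ≤m (∈-++⁺ʳ L (there z∈R))) (≢-sym (All.lookup (AllPairs.head UmR) z∈R))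
  R<L : ∀ {y z} → y ∈ L → z ∈ R → z < y
  R<L y∈L z∈R =
    ≤∧≢⇒< (Avoids132-split L m R av y∈L z∈R (All.lookup R<m z∈R)) (≢-sym (L#mR y∈L (there z∈R)))

Peak-fAux : ∀ k w → length w ≤ k → Unique w → Avoids132 w → ∀ {a i} → Peak (fAux k w) a i ⇔ RankedLMin w a i
Peak-fAux zero    []      _  _ _  = mk⇔ (λ ()) (λ { (_ , () , _) })
Peak-fAux (suc k) []      _  _ _  = mk⇔ (λ ()) (λ { (_ , () , _) })
Peak-fAux (suc k) (x ∷ w) le U av {a} {i} =
  subst₂ (λ P v → Peak P a i ⇔ RankedLMin v a i) (sym (fAux-suc x w k)) (sym split)
    (Peak-fAux-glue k (maxLeft x w) (maxL (x ∷ w)) (maxRight x w) (Peak-fAux k)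
       (along (λ v → length v ≤ suc k) le) (along Unique U) (along Avoids132 av)
       (along (All (_≤ maxL (x ∷ w))) (maxL-upper (x ∷ w))))
  where
  split : x ∷ w ≡ maxLeft x w ++ maxL (x ∷ w) ∷ maxRight x w
  split = split-at-max x w
  along : (P : List ℕ → Set) → P (x ∷ w) → P (maxLeft x w ++ maxL (x ∷ w) ∷ maxRight x w)
  along P = subst P split

-- Permutations

rank-upTo : ∀ n v → rank (map suc (upTo n)) (suc v) ≡ n ∸ v
rank-upTo zero    v = sym (0∸n≡0 v)
rank-upTo (suc n) v = begin
  rank (map suc (upTo (suc n))) (suc v)                     ≡⟨ cong (λ A → rank A (suc v)) upTo-suc ⟩
  rank (map suc (upTo n) ++ [ suc n ]) (suc v)              ≡⟨ rank-++ (map suc (upTo n)) _ (suc v) ⟩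
  rank (map suc (upTo n)) (suc v) + rank [ suc n ] (suc v)  ≡⟨ cong (_+ rank [ suc n ] (suc v)) (rank-upTo n v) ⟩
  n ∸ v + rank [ suc n ] (suc v)                            ≡⟨ last-step ⟩
  suc n ∸ v                                                 ∎
  where
  open ≡-Reasoning
  upTo-suc : map suc (upTo (suc n)) ≡ map suc (upTo n) ++ [ suc n ]
  upTo-suc = trans (cong (map suc) (sym (upTo-∷ʳ n))) (map-++ suc (upTo n) [ n ])
  last-step : n ∸ v + rank [ suc n ] (suc v) ≡ suc n ∸ v
  last-step with v ≤? n
  ... | yes v≤n = begin
    n ∸ v + rank [ suc n ] (suc v)  ≡⟨ cong (n ∸ v +_) (rank-∷-≤ [] (s≤s v≤n)) ⟩
    n ∸ v + 1                       ≡⟨ +-comm (n ∸ v) 1 ⟩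
    suc (n ∸ v)                     ≡⟨ sym (+-∸-assoc 1 v≤n) ⟩
    suc n ∸ v                       ∎
  ... | no v≰n = begin
    n ∸ v + rank [ suc n ] (suc v)  ≡⟨ cong₂ _+_ (m≤n⇒m∸n≡0 (<⇒≤ n<v)) (rank-all< [ suc n ] (s≤s n<v ∷ [])) ⟩
    0                               ≡⟨ sym (m≤n⇒m∸n≡0 n<v) ⟩
    suc n ∸ v                       ∎
    where
    n<v : n < v
    n<v = ≰⇒> v≰n

module _ {n π} (perm : IsPerm n π) where

  IsPerm-length : length π ≡ n
  IsPerm-length = trans (↭-length perm) (trans (length-map suc (upTo n)) (length-upTo n))

  IsPerm-Unique : Unique π
  IsPerm-Unique = Unique-resp-↭ (↭⇒↭ₛ (↭-sym perm)) (map⁺ suc-injective (upTo⁺ n))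

  IsPerm-rank : ∀ {v} → v ∈ π → rank π v + v ≡ n + 1
  IsPerm-rank {v} v∈π with ∈-map⁻ suc (∈-resp-↭ perm v∈π)
  ... | v′ , v′∈ , refl = begin
    rank π (suc v′) + suc v′                            ≡⟨ cong (_+ suc v′) (rank-↭ (suc v′) perm) ⟩
    rank (map suc (upTo n)) (suc v′) + suc v′           ≡⟨ cong (_+ suc v′) (rank-upTo n v′) ⟩
    n ∸ v′ + suc v′                                     ≡⟨ +-suc (n ∸ v′) v′ ⟩
    suc (n ∸ v′ + v′)                                   ≡⟨ cong suc (m∸n+n≡m (<⇒≤ (∈-upTo⁻ v′∈))) ⟩
    suc n                                               ≡⟨ +-comm 1 n ⟩
    n + 1                                               ∎
    where open ≡-Reasoning

  RankedLMin⇔LMIN : ∀ {a i} → a ≤ n → RankedLMin π a i ⇔ LMIN π i (n + 1 ∸ a)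
  RankedLMin⇔LMIN {a} {i} a≤n = mk⇔ to from
    where
    to : RankedLMin π a i → LMIN π i (n + 1 ∸ a)
    to (v , lm , refl) = subst (LMIN π i) (sym v≡) (Equivalence.from (LMIN⇔LeftMin π) lm)
      where
      v≡ : n + 1 ∸ rank π v ≡ v
      v≡ = trans (cong (_∸ rank π v) (sym (IsPerm-rank (LeftMin-∈ π lm)))) (m+n∸m≡n (rank π v) v)
    from : LMIN π i (n + 1 ∸ a) → RankedLMin π a i
    from l = n + 1 ∸ a , lm , (begin
      rank π v             ≡⟨ sym (m+n∸n≡m (rank π v) v) ⟩
      rank π v + v ∸ v     ≡⟨ cong (_∸ v) (IsPerm-rank (LeftMin-∈ π lm)) ⟩
      n + 1 ∸ v            ≡⟨ m∸[m∸n]≡n (≤-trans a≤n (m≤m+n n 1)) ⟩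
      a                    ∎)
      where
      open ≡-Reasoning
      v : ℕ
      v = n + 1 ∸ a
      lm : LeftMin π i v
      lm = Equivalence.to (LMIN⇔LeftMin π) l

lemma4 : (n : ℕ) → 1 ≤ n → (π : List ℕ) → IsPerm n π → Avoids132 π →
    (P : List Step) → IsDyck n P →
    (f π ≡ P ⇔ (∀ (i a : ℕ) → 1 ≤ i → i ≤ n → 1 ≤ a → a ≤ n →
    (LMIN π i (n + 1 ∸ a) ⇔ PEAK P a i)))
lemma4 n _ π perm av P (upP , DP) = mk⇔ to from
  where
  LMIN⇔PEAK-f : ∀ {a i} → a ≤ n → LMIN π i (n + 1 ∸ a) ⇔ PEAK (f π) a i
  LMIN⇔PEAK-f a≤n = ⇔-sym (RankedLMin⇔LMIN perm a≤n
                      ⇔-∘ (Peak-fAux (length π) π ≤-refl (IsPerm-Unique perm) av ⇔-∘ PEAK⇔Peak (f π)))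
  to : f π ≡ P → ∀ i a → 1 ≤ i → i ≤ n → 1 ≤ a → a ≤ n → LMIN π i (n + 1 ∸ a) ⇔ PEAK P a i
  to refl i a _ _ _ a≤n = LMIN⇔PEAK-f a≤n
  from : (∀ i a → 1 ≤ i → i ≤ n → 1 ≤ a → a ≤ n → LMIN π i (n + 1 ∸ a) ⇔ PEAK P a i) → f π ≡ P
  from agree =
    PEAK-injective (f π) P
      (trans (fAux-countU (length π) π ≤-refl) (IsPerm-length perm))
      (trans (fAux-countD (length π) π ≤-refl) (IsPerm-length perm))
      upP (trans (sym (DyckFrom-counts 0 P DP)) upP)
      (λ i a 1≤i i≤n 1≤a a≤n → agree i a 1≤i i≤n 1≤a a≤n ⇔-∘ ⇔-sym (LMIN⇔PEAK-f a≤n))
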